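{- An integral quantale is simple if and only if it is either the one-element quantale or the two-element chain $\{\bot,\top\}$.
   Context: A unital quantale is a complete lattice with an associative multiplication with unit $1$ distributing over arbitrary joins in both arguments; it is integral if $1=\top$. A quantale congruence is an equivalence relation compatible with arbitrary joins and multiplication; a quantale is simple if its only congruences are the identity relation and the total relation. -}

module Defs where

open import Level using (Level; suc; _⊔_)
open import Data.Product using (_×_; Σ)
open import Data.Sum using (_⊎_)
open import Relation.Nullary using (¬_)
open import Relation.Binary.Core using (Rel)
open import Relation.Binary.Structures using (IsPartialOrder; IsEquivalence)
open import Relation.Binary.PropositionalEquality using (_≡_)

record Quantale (ℓ : Level) : Set (suc ℓ) where
  infixl 7 _·_
  infix 4 _≤_
  field
    Carrier    : Set ℓ
    _≤_        : Rel Carrier ℓ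
    isPartialOrder : IsPartialOrder _≡_ _≤_
    ⋁          : {I : Set ℓ} → (I → Carrier) → Carrier
    ⋁-upper    : {I : Set ℓ} (f : I → Carrier) (i : I) → f i ≤ ⋁ f
    ⋁-least    : {I : Set ℓ} (f : I → Carrier) (u : Carrier) →
                 ((i : I) → f i ≤ u) → ⋁ f ≤ u
    _·_        : Carrier → Carrier → Carrier
    1q         : Carrier
    ·-assoc    : ∀ a b c → (a · b) · c ≡ a · (b · c)
    ·-identityˡ : ∀ a → 1q · a ≡ a
    ·-identityʳ : ∀ a → a · 1q ≡ a
    ·-distribˡ-⋁ : ∀ a {I : Set ℓ} (f : I → Carrier) → a · ⋁ f ≡ ⋁ (λ i → a · f i)
    ·-distribʳ-⋁ : ∀ a {I : Set ℓ} (f : I → Carrier) → ⋁ f · a ≡ ⋁ (λ i → f i · a)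

  ⊤q : Carrier
  ⊤q = ⋁ {Carrier} (λ x → x)

  ⊥q : Carrier
  ⊥q = ⋁ {Σ Carrier (λ x → ¬ (x ≡ x))} (λ p → Σ.proj₁ p)

open Quantale public

IsIntegral : ∀ {ℓ} → Quantale ℓ → Set ℓ
IsIntegral Q = 1q Q ≡ ⊤q Q

record IsCongruence {ℓ} (Q : Quantale ℓ) (θ : Rel (Carrier Q) ℓ) : Set (suc ℓ) where
  field
    isEquivalence : IsEquivalence θ
    ⋁-compat : {I : Set ℓ} (f g : I → Carrier Q) →
               ((i : I) → θ (f i) (g i)) → θ (⋁ Q f) (⋁ Q g)
    ·-compat : ∀ {a b c d} → θ a b → θ c d → θ (_·_ Q a c) (_·_ Q b d)

IsIdentityRel : ∀ {ℓ} {A : Set ℓ} → Rel A ℓ → Set ℓ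
IsIdentityRel {A = A} θ = (x y : A) → (θ x y → x ≡ y) × (x ≡ y → θ x y)

IsTotalRel : ∀ {ℓ} {A : Set ℓ} → Rel A ℓ → Set ℓ
IsTotalRel {A = A} θ = (x y : A) → θ x y

IsSimple : ∀ {ℓ} → Quantale ℓ → Set (suc ℓ)
IsSimple Q = (θ : Rel (Carrier Q) _) → IsCongruence Q θ →
             IsIdentityRel θ ⊎ IsTotalRel θ

IsOneElement : ∀ {ℓ} → Quantale ℓ → Set ℓ
IsOneElement Q = (x y : Carrier Q) → x ≡ y

IsTwoElementChain : ∀ {ℓ} → Quantale ℓ → Set ℓ
IsTwoElementChain Q = ¬ (⊥q Q ≡ ⊤q Q) × ((x : Carrier Q) → (x ≡ ⊥q Q) ⊎ (x ≡ ⊤q Q))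

module Submission where

-- The central notion is "Q is bipolar": every element equals ⊥ or ⊤.
--  * Simple ⇒ bipolar.  For each a, "x ∨ a ≡ y ∨ a" is a congruence (it
--    collapses the down-set of a).  Compatibility with multiplication rests
--    on integrality: a · z ≤ a, so (x ∨ a) · z ∨ a ≡ x · z ∨ a.  By
--    simplicity this congruence is the identity (then ⊥ ∨ a ≡ a ∨ a forces
--    a ≡ ⊥) or total (then ⊤ ∨ a ≡ a ∨ a forces a ≡ ⊤).
--  * Bipolar ⇒ simple.  On a set whose elements are all one of two points,
--    every equivalence relation is the identity or total, according to
--    whether it relates the two points (decided by excluded middle).
--  * Bipolar ⇔ one-element or two-element chain, splitting on ⊥ ≡ ⊤.
-- Facts about multiplication are proved on the right only; the left versions
-- are the same facts in the opposite quantale.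

open import Defs using (Quantale; IsIntegral; IsCongruence; IsSimple; IsIdentityRel; IsTotalRel; IsOneElement; IsTwoElementChain; ⊥q; ⊤q)
open import Level using (Level; Lift; lift)
open import Data.Bool using (Bool; true; false)
open import Data.Empty using (⊥-elim)
open import Data.Product using (_,_; proj₁; proj₂)
open import Data.Sum using (_⊎_; inj₁; inj₂)
open import Function.Bundles using (_⇔_; mk⇔)
open import Axiom.ExcludedMiddle using (ExcludedMiddle)
open import Relation.Nullary using (yes; no)
open import Relation.Binary.Core using (Rel)
open import Relation.Binary.Structures using (IsPartialOrder; IsEquivalence)
open import Relation.Binary.PropositionalEquality using (_≡_; refl; sym; trans; cong; module ≡-Reasoning)

private
  variable
    ℓ : Level

opposite : Quantale ℓ → Quantale ℓ
opposite Q = record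
  { Carrier        = Carrier
  ; _≤_            = _≤_
  ; isPartialOrder = isPartialOrder
  ; ⋁              = ⋁
  ; ⋁-upper        = ⋁-upper
  ; ⋁-least        = ⋁-least
  ; _·_            = λ a b → b · a
  ; 1q             = 1q
  ; ·-assoc        = λ a b c → sym (·-assoc c b a)
  ; ·-identityˡ    = ·-identityʳ
  ; ·-identityʳ    = ·-identityˡ
  ; ·-distribˡ-⋁   = ·-distribʳ-⋁
  ; ·-distribʳ-⋁   = ·-distribˡ-⋁
  }
  where open Quantale Q

-- The two-element family (a, b), indexed at level ℓ so binary joins are ⋁s.
-- It does not depend on the quantale, so a quantale and its opposite have
-- definitionally the same binary joins.
pair : {A : Set ℓ} → A → A → Lift ℓ Bool → A
pair a b (lift true)  = a
pair a b (lift false) = b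

module Joins (Q : Quantale ℓ) where
  open Quantale Q hiding (⊥q; ⊤q) renaming (Carrier to C)
  open IsPartialOrder isPartialOrder public
    using (antisym; reflexive) renaming (refl to ≤-refl; trans to ≤-trans)

  infixl 6 _∨_
  _∨_ : C → C → C
  a ∨ b = ⋁ (pair a b)

  ∨-upperˡ : ∀ a b → a ≤ a ∨ b
  ∨-upperˡ a b = ⋁-upper (pair a b) (lift true)

  ∨-upperʳ : ∀ a b → b ≤ a ∨ b
  ∨-upperʳ a b = ⋁-upper (pair a b) (lift false)

  ∨-least : ∀ {a b c} → a ≤ c → b ≤ c → a ∨ b ≤ c
  ∨-least {a} {b} {c} a≤c b≤c =
    ⋁-least (pair a b) c λ { (lift true) → a≤c ; (lift false) → b≤c }

  -- Joins of pointwise equal families agree (without function extensionality).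
  ⋁-pointwise : ∀ {I : Set ℓ} {f g : I → C} → (∀ i → f i ≡ g i) → ⋁ f ≡ ⋁ g
  ⋁-pointwise {f = f} {g} f≗g = antisym
    (⋁-least f (⋁ g) λ i → ≤-trans (reflexive (f≗g i)) (⋁-upper g i))
    (⋁-least g (⋁ f) λ i → ≤-trans (reflexive (sym (f≗g i))) (⋁-upper f i))

  ⊥-least : ∀ x → ⊥q Q ≤ x
  ⊥-least x = ⋁-least _ x λ p → ⊥-elim (proj₂ p refl)

  ⊤-greatest : ∀ x → x ≤ ⊤q Q
  ⊤-greatest x = ⋁-upper (λ y → y) x

  ≤⇒∨≡ : ∀ {x y} → x ≤ y → x ∨ y ≡ y
  ≤⇒∨≡ x≤y = antisym (∨-least x≤y ≤-refl) (∨-upperʳ _ _)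

  ∨-idem : ∀ a → a ∨ a ≡ a
  ∨-idem a = ≤⇒∨≡ ≤-refl

  ⊥-∨ : ∀ a → ⊥q Q ∨ a ≡ a
  ⊥-∨ a = ≤⇒∨≡ (⊥-least a)

  ⊤-∨ : ∀ a → ⊤q Q ∨ a ≡ ⊤q Q
  ⊤-∨ a = antisym (⊤-greatest _) (∨-upperˡ _ _)

  ∨-absorb : ∀ {b c a} → c ≤ a → (b ∨ c) ∨ a ≡ b ∨ a
  ∨-absorb {b} {c} {a} c≤a = antisym
    (∨-least (∨-least (∨-upperˡ b a) (≤-trans c≤a (∨-upperʳ b a))) (∨-upperʳ _ a))
    (∨-least (≤-trans (∨-upperˡ b c) (∨-upperˡ _ a)) (∨-upperʳ _ a))

  ·-distribʳ-∨ : ∀ x y z → (x ∨ y) · z ≡ x · z ∨ y · z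
  ·-distribʳ-∨ x y z = trans (·-distribʳ-⋁ z (pair x y))
    (⋁-pointwise λ { (lift true) → refl ; (lift false) → refl })

  ·-monoˡ : ∀ {x y} z → x ≤ y → x · z ≤ y · z
  ·-monoˡ {x} {y} z x≤y = ≤-trans (∨-upperˡ (x · z) (y · z))
    (reflexive (trans (sym (·-distribʳ-∨ x y z)) (cong (_· z) (≤⇒∨≡ x≤y))))

module IntegralRight (Q : Quantale ℓ) (integral : IsIntegral Q) where
  open Quantale Q hiding (⊥q; ⊤q) renaming (Carrier to C)
  open Joins Q
  -- monotonicity in the right factor is monotonicity on the left in Qᵒᵖ
  open Joins (opposite Q) using () renaming (·-monoˡ to ·-monoʳ)

  ·-decreasingʳ : ∀ a z → a · z ≤ a
  ·-decreasingʳ a z = ≤-trans (·-monoʳ a (⊤-greatest z))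
    (reflexive (trans (cong (a ·_) (sym integral)) (·-identityʳ a)))

  Collapse : C → Rel C ℓ
  Collapse a x y = x ∨ a ≡ y ∨ a

  ·-∨-absorbʳ : ∀ a x z → (x ∨ a) · z ∨ a ≡ x · z ∨ a
  ·-∨-absorbʳ a x z = trans (cong (_∨ a) (·-distribʳ-∨ x a z)) (∨-absorb (·-decreasingʳ a z))

  collapse-·ʳ : ∀ a {x y} z → Collapse a x y → Collapse a (x · z) (y · z)
  collapse-·ʳ a {x} {y} z x∼y = begin
    x · z ∨ a        ≡⟨ sym (·-∨-absorbʳ a x z) ⟩
    (x ∨ a) · z ∨ a  ≡⟨ cong (λ w → w · z ∨ a) x∼y ⟩
    (y ∨ a) · z ∨ a  ≡⟨ ·-∨-absorbʳ a y z ⟩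
    y · z ∨ a        ∎
    where open ≡-Reasoning

IsBipolar : Quantale ℓ → Set ℓ
IsBipolar Q = ∀ x → x ≡ ⊥q Q ⊎ x ≡ ⊤q Q

module Integral (Q : Quantale ℓ) (integral : IsIntegral Q) where
  open Quantale Q hiding (⊥q; ⊤q) renaming (Carrier to C)
  open Joins Q
  open IntegralRight Q integral
  open IntegralRight (opposite Q) integral using () renaming (collapse-·ʳ to collapse-·ˡ)

  collapse-⋁-≤ : ∀ a {I : Set ℓ} (f g : I → C) → (∀ i → Collapse a (f i) (g i)) →
                 ⋁ f ∨ a ≤ ⋁ g ∨ a
  collapse-⋁-≤ a f g f∼g = ∨-least (⋁-least f _ f≤) (∨-upperʳ _ a)
    where
    f≤ : ∀ i → f i ≤ ⋁ g ∨ a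
    f≤ i = ≤-trans (∨-upperˡ (f i) a) (≤-trans (reflexive (f∼g i))
             (∨-least (≤-trans (⋁-upper g i) (∨-upperˡ _ a)) (∨-upperʳ _ a)))

  -- Multiplicative compatibility: x·u ∼ y·u (right) and y·u ∼ y·v (left, via Qᵒᵖ).
  collapse-isCongruence : ∀ a → IsCongruence Q (Collapse a)
  collapse-isCongruence a = record
    { isEquivalence = record { refl = refl ; sym = sym ; trans = trans }
    ; ⋁-compat = λ f g f∼g →
        antisym (collapse-⋁-≤ a f g f∼g) (collapse-⋁-≤ a g f (λ i → sym (f∼g i)))
    ; ·-compat = λ {x} {y} {u} {v} x∼y u∼v →
        trans (collapse-·ʳ a u x∼y) (collapse-·ˡ a y u∼v)
    }

  simple⇒bipolar : IsSimple Q → IsBipolar Q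
  simple⇒bipolar simple a with simple (Collapse a) (collapse-isCongruence a)
  ... | inj₁ identity = inj₁ (sym (proj₁ (identity (⊥q Q) a) (trans (⊥-∨ a) (sym (∨-idem a)))))
  ... | inj₂ total    = inj₂ (trans (sym (∨-idem a)) (trans (sym (total (⊤q Q) a)) (⊤-∨ a)))

equivalence-on-two-points : ∀ {A : Set ℓ} → ExcludedMiddle ℓ → (b t : A) →
  (∀ x → x ≡ b ⊎ x ≡ t) → (θ : Rel A ℓ) → IsEquivalence θ →
  IsIdentityRel θ ⊎ IsTotalRel θ
equivalence-on-two-points em b t two θ equiv with em {θ b t}
... | yes b∼t = inj₂ total
  where
  open IsEquivalence equiv renaming (refl to θ-refl; sym to θ-sym)
  total : ∀ x y → θ x y
  total x y with two x | two y
  ... | inj₁ refl | inj₁ refl = θ-refl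
  ... | inj₁ refl | inj₂ refl = b∼t
  ... | inj₂ refl | inj₁ refl = θ-sym b∼t
  ... | inj₂ refl | inj₂ refl = θ-refl
... | no b≁t = inj₁ λ x y → related⇒equal x y , λ { refl → θ-refl }
  where
  open IsEquivalence equiv renaming (refl to θ-refl; sym to θ-sym)
  related⇒equal : ∀ x y → θ x y → x ≡ y
  related⇒equal x y x∼y with two x | two y
  ... | inj₁ refl | inj₁ refl = refl
  ... | inj₁ refl | inj₂ refl = ⊥-elim (b≁t x∼y)
  ... | inj₂ refl | inj₁ refl = ⊥-elim (b≁t (θ-sym x∼y))
  ... | inj₂ refl | inj₂ refl = refl

bipolar⇒simple : ExcludedMiddle ℓ → (Q : Quantale ℓ) → IsBipolar Q → IsSimple Q
bipolar⇒simple em Q bipolar θ congruence =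
  equivalence-on-two-points em (⊥q Q) (⊤q Q) bipolar θ (IsCongruence.isEquivalence congruence)

bipolar⇒small : ExcludedMiddle ℓ → (Q : Quantale ℓ) → IsBipolar Q →
  IsOneElement Q ⊎ IsTwoElementChain Q
bipolar⇒small em Q bipolar with em {⊥q Q ≡ ⊤q Q}
... | yes ⊥≡⊤ = inj₁ λ x y → trans (bottom x) (sym (bottom y))
  where
  bottom : ∀ x → x ≡ ⊥q Q
  bottom x with bipolar x
  ... | inj₁ x≡⊥ = x≡⊥
  ... | inj₂ x≡⊤ = trans x≡⊤ (sym ⊥≡⊤)
... | no ⊥≢⊤ = inj₂ (⊥≢⊤ , bipolar)

small⇒bipolar : (Q : Quantale ℓ) → IsOneElement Q ⊎ IsTwoElementChain Q → IsBipolar Q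
small⇒bipolar Q (inj₁ oneElement) x = inj₁ (oneElement x (⊥q Q))
small⇒bipolar Q (inj₂ chain)      = proj₂ chain

corollary4p4 : ∀ {ℓ} → ExcludedMiddle ℓ → (Q : Quantale ℓ) → IsIntegral Q →
    IsSimple Q ⇔ (IsOneElement Q ⊎ IsTwoElementChain Q)
corollary4p4 em Q integral = mk⇔
  (λ simple → bipolar⇒small em Q (Integral.simple⇒bipolar Q integral simple))
  (λ small → bipolar⇒simple em Q (small⇒bipolar Q small))
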